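{- Let $k\ge 1$ and let $A=a_1\ldots a_n$, $B=b_1\ldots b_n$ be sequences over an alphabet $\Sigma$. Define the matrix $M(i,j)$, $0\le i,j\le n$, by $M(i,j)=0$ whenever $i<k$ or $j<k$, and for $i,j\ge k$: $M(i,j)=M(i-k,j-k)+1$ if $A_{i-k+1\ldots i}=B_{j-k+1\ldots j}$, and $M(i,j)=\max(M(i,j-1),M(i-1,j))$ otherwise. Then for every $i,j$, $M(i,j)$ equals $\mathrm{LCSk}(A_{1\ldots i},B_{1\ldots j})$.
   Context: $X_{p\ldots q}$ denotes the substring $x_p x_{p+1}\ldots x_q$ of a sequence $X$. For sequences $X=x_1\ldots x_{n_1}$, $Y=y_1\ldots y_{n_2}$ and an integer $k\ge1$, $\mathrm{LCSk}(X,Y)$ (the length of the longest common subsequence in $k$-length substrings) is the maximal $\ell\ge 0$ such that there exist indices $i_1<\dots<i_\ell$ and $j_1<\dots<j_\ell$ with $k\le i_e\le n_1$, $k\le j_e\le n_2$, $X_{i_e-k+1\ldots i_e}=Y_{j_e-k+1\ldots j_e}$ for every $e$, and $i_e+k\le i_{e+1}$, $j_e+k\le j_{e+1}$ for every $1\le e<\ell$ (the chosen length-$k$ substrings are non-overlapping in each sequence). -}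

module Defs where

open import Data.Nat using (ℕ; zero; suc; _+_; _∸_; _≤_; _<_; _<?_; _⊔_)
open import Data.Product using (_×_; _,_; ∃)
open import Data.List using (List; take; drop; length)
import Data.List.Properties as LP
open import Data.List.Relation.Unary.All using (All)
open import Data.List.Relation.Unary.Linked using (Linked)
open import Relation.Nullary using (yes; no)
open import Relation.Binary.Definitions using (DecidableEquality)
open import Relation.Binary.PropositionalEquality using (_≡_)

-- X_{p..q} (1-indexed, inclusive): the substring x_p ... x_q
substr : {Σ : Set} → List Σ → ℕ → ℕ → List Σ
substr X p q = take (suc q ∸ p) (drop (p ∸ 1) X)

KMatch : {Σ : Set} → ℕ → List Σ → List Σ → ℕ × ℕ → Set
KMatch k X Y (i , j) =
  k ≤ i × i ≤ length X × k ≤ j × j ≤ length Y ×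
  substr X (suc (i ∸ k)) i ≡ substr Y (suc (j ∸ k)) j

KSep : ℕ → ℕ × ℕ → ℕ × ℕ → Set
KSep k (i , j) (i' , j') = i + k ≤ i' × j + k ≤ j'

-- a list of index pairs ((i_1,j_1), ..., (i_ℓ,j_ℓ)) witnessing a common
-- subsequence in k-length substrings
ValidLCSk : {Σ : Set} → ℕ → List Σ → List Σ → List (ℕ × ℕ) → Set
ValidLCSk k X Y ps = All (KMatch k X Y) ps × Linked (KSep k) ps

IsLCSk : {Σ : Set} → ℕ → List Σ → List Σ → ℕ → Set
IsLCSk k X Y ℓ =
  (∃ λ ps → ValidLCSk k X Y ps × length ps ≡ ℓ) ×
  (∀ ps → ValidLCSk k X Y ps → length ps ≤ ℓ)

-- The matrix M of the statement, computed with fuel (fuel i + j suffices,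
-- since every recursive call decreases i + j when k ≥ 1).
module _ {Σ : Set} (_≟_ : DecidableEquality Σ) (k : ℕ) (A B : List Σ) where

  Mfuel : ℕ → ℕ → ℕ → ℕ
  Mfuel zero i j = 0
  Mfuel (suc f) i j with i <? k | j <? k
  ... | yes _ | _ = 0
  ... | no _ | yes _ = 0
  ... | no _ | no _ with LP.≡-dec _≟_ (substr A (suc (i ∸ k)) i) (substr B (suc (j ∸ k)) j)
  ...   | yes _ = suc (Mfuel f (i ∸ k) (j ∸ k))
  ...   | no _ = Mfuel f i (j ∸ 1) ⊔ Mfuel f (i ∸ 1) j

  M : ℕ → ℕ → ℕ
  M i j = Mfuel (i + j) i j

-- Let the chains be the witnesses of LCSk for the prefixes A₁…ᵢ, B₁…ⱼ.  If the last k-blocks of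
-- the prefixes agree, separation keeps all but the last pair of a chain inside A₁…ᵢ₋ₖ, B₁…ⱼ₋ₖ;
-- if they differ, the last pair is not (i , j), so the chain lies inside A₁…ᵢ₋₁, B₁…ⱼ or
-- A₁…ᵢ, B₁…ⱼ₋₁.  By induction this bounds every chain by M, and each case of the recurrence
-- is realised by extending, respectively reusing, an optimal chain of the smaller instance.
module Submission where

open import Defs
open import Data.Nat using (ℕ; zero; suc; _+_; _∸_; _≤_; _<_; _<?_; _≤?_; _⊔_; _⊓_; z≤n; s≤s; z<s)
open import Data.Nat.Properties
open import Data.Product using (_×_; _,_; ∃)
open import Data.Sum using (_⊎_; inj₁; inj₂)
open import Data.List using (List; []; _∷_; _∷ʳ_; take; drop; length; initLast; _∷ʳ′_)
import Data.List.Properties as List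
open import Data.List.Relation.Unary.All using (All; []; _∷_)
import Data.List.Relation.Unary.All as All
import Data.List.Relation.Unary.All.Properties as All
open import Data.List.Relation.Unary.Linked using (Linked; []; [-]; _∷_)
open import Data.Vec using (Vec; toList)
import Data.Vec.Properties as Vec
open import Relation.Nullary using (¬_; yes; no; contradiction)
open import Relation.Binary.Definitions using (DecidableEquality; Transitive)
open import Relation.Binary.PropositionalEquality
  using (_≡_; refl; sym; trans; cong; subst; module ≡-Reasoning)

module _ {A : Set} where

  length-∷ʳ : ∀ (xs : List A) x → length (xs ∷ʳ x) ≡ suc (length xs)
  length-∷ʳ xs x = trans (List.length-++ xs) (+-comm (length xs) 1)

  length-take-≤ : ∀ {n} (xs : List A) → n ≤ length xs → length (take n xs) ≡ n
  length-take-≤ {n} xs n≤ = trans (List.length-take n xs) (m≤n⇒m⊓n≡m n≤)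

  take-drop-take : ∀ a d m (xs : List A) → d + a ≤ m →
                   take a (drop d (take m xs)) ≡ take a (drop d xs)
  take-drop-take a d m xs d+a≤m = begin
    take a (drop d (take m xs))         ≡⟨ List.take-drop a d (take m xs) ⟩
    drop d (take (d + a) (take m xs))   ≡⟨ cong (drop d) (List.take-take (d + a) m xs) ⟩
    drop d (take ((d + a) ⊓ m) xs)      ≡⟨ cong (λ n → drop d (take n xs)) (m≤n⇒m⊓n≡m d+a≤m) ⟩
    drop d (take (d + a) xs)            ≡⟨ List.take-drop a d xs ⟨
    take a (drop d xs)                  ∎
    where open ≡-Reasoning

  substr-take : ∀ {m q} s (xs : List A) → q ≤ m → substr (take m xs) (suc s) q ≡ substr xs (suc s) q
  substr-take {m} {q} s xs q≤m with s ≤? q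
  ... | yes s≤q = take-drop-take (q ∸ s) s m xs (subst (_≤ m) (sym (m+[n∸m]≡n s≤q)) q≤m)
  ... | no s≰q rewrite m≤n⇒m∸n≡0 (≰⇒≥ s≰q) = refl

module _ {A : Set} {R : A → A → Set} where

  Linked-∷ʳ⁻ : ∀ xs {x} → Linked R (xs ∷ʳ x) → Linked R xs
  Linked-∷ʳ⁻ []           _       = []
  Linked-∷ʳ⁻ (y ∷ [])     _       = [-]
  Linked-∷ʳ⁻ (y ∷ z ∷ xs) (r ∷ l) = r ∷ Linked-∷ʳ⁻ (z ∷ xs) l

  Linked-∷ʳ⁺ : ∀ xs {x} → Linked R xs → All (λ y → R y x) xs → Linked R (xs ∷ʳ x)
  Linked-∷ʳ⁺ []           _       _       = [-]
  Linked-∷ʳ⁺ (y ∷ [])     _       (r ∷ _) = r ∷ [-]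
  Linked-∷ʳ⁺ (y ∷ z ∷ xs) (r ∷ l) (_ ∷ a) = r ∷ Linked-∷ʳ⁺ (z ∷ xs) l a

  Linked-∷ʳ⇒All : Transitive R → ∀ xs {x} → Linked R (xs ∷ʳ x) → All (λ y → R y x) xs
  Linked-∷ʳ⇒All R-trans []           _ = []
  Linked-∷ʳ⇒All R-trans (y ∷ [])     (r ∷ _) = r ∷ []
  Linked-∷ʳ⇒All R-trans (y ∷ z ∷ xs) (r ∷ l) with Linked-∷ʳ⇒All R-trans (z ∷ xs) l
  ... | rz ∷ rs = R-trans r rz ∷ rz ∷ rs

KSep-trans : ∀ k → Transitive (KSep k)
KSep-trans k {_} {p , q} (ap , aq) (bp , bq) =
  ≤-trans ap (≤-trans (m≤m+n p k) bp) , ≤-trans aq (≤-trans (m≤m+n q k) bq)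

module LCSk {Σ : Set} (_≟_ : DecidableEquality Σ) (k : ℕ) (1≤k : 1 ≤ k) (A B : List Σ) where

  Mf : ℕ → ℕ → ℕ → ℕ
  Mf = Mfuel _≟_ k A B

  SameBlock : ℕ → ℕ → Set
  SameBlock i j = substr A (suc (i ∸ k)) i ≡ substr B (suc (j ∸ k)) j

  Match : ℕ × ℕ → Set
  Match (p , q) = k ≤ p × k ≤ q × SameBlock p q

  Within : ℕ → ℕ → ℕ × ℕ → Set
  Within i j (p , q) = p ≤ i × q ≤ j

  record Chain (i j : ℕ) (ps : List (ℕ × ℕ)) : Set where
    constructor chain
    field
      matches   : All Match ps
      within    : All (Within i j) ps
      separated : Linked (KSep k) ps

  -- Indexed by the value, so that  with Mf (suc f) i j | recurrence f i j  unfolds M in the goal.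
  data Recurrence (f i j : ℕ) : ℕ → Set where
    border   : i < k ⊎ j < k → Recurrence f i j 0
    match    : k ≤ i → k ≤ j → SameBlock i j → Recurrence f i j (suc (Mf f (i ∸ k) (j ∸ k)))
    mismatch : k ≤ i → k ≤ j → ¬ SameBlock i j → Recurrence f i j (Mf f i (j ∸ 1) ⊔ Mf f (i ∸ 1) j)

  recurrence : ∀ f i j → Recurrence f i j (Mf (suc f) i j)
  recurrence f i j with i <? k | j <? k
  ... | yes i<k | _       = border (inj₁ i<k)
  ... | no _    | yes j<k = border (inj₂ j<k)
  ... | no i≮k  | no j≮k  with List.≡-dec _≟_ (substr A (suc (i ∸ k)) i) (substr B (suc (j ∸ k)) j)
  ...   | yes same = match    (≮⇒≥ i≮k) (≮⇒≥ j≮k) same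
  ...   | no ¬same = mismatch (≮⇒≥ i≮k) (≮⇒≥ j≮k) ¬same

  chain-[] : ∀ {i j} → Chain i j []
  chain-[] = chain [] [] []

  chain-mono : ∀ {i j i′ j′ ps} → i ≤ i′ → j ≤ j′ → Chain i j ps → Chain i′ j′ ps
  chain-mono i≤i′ j≤j′ (chain ms ws ls) =
    chain ms (All.map (λ (p≤i , q≤j) → ≤-trans p≤i i≤i′ , ≤-trans q≤j j≤j′) ws) ls

  chain-below-k : ∀ {i j ps} → i < k ⊎ j < k → Chain i j ps → ps ≡ []
  chain-below-k {ps = []}    _ _ = refl
  chain-below-k {ps = _ ∷ _} (inj₁ i<k) (chain ((k≤p , _) ∷ _) ((p≤i , _) ∷ _) _) =
    contradiction (≤-trans k≤p p≤i) (<⇒≱ i<k)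
  chain-below-k {ps = _ ∷ _} (inj₂ j<k) (chain ((_ , k≤q , _) ∷ _) ((_ , q≤j) ∷ _) _) =
    contradiction (≤-trans k≤q q≤j) (<⇒≱ j<k)

  within-before-last : ∀ xs {p q} → Linked (KSep k) (xs ∷ʳ (p , q)) → All (Within (p ∸ k) (q ∸ k)) xs
  within-before-last xs l =
    All.map (λ (a , b) → m+n≤o⇒m≤o∸n _ a , m+n≤o⇒m≤o∸n _ b) (Linked-∷ʳ⇒All (KSep-trans k) xs l)

  chain-∷ʳ : ∀ {i j ps} → Match (i , j) → Chain (i ∸ k) (j ∸ k) ps → Chain i j (ps ∷ʳ (i , j))
  chain-∷ʳ {i} {j} {ps} m@(k≤i , k≤j , _) (chain ms ws ls) =
    chain (All.++⁺ ms (m ∷ []))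
          (All.++⁺ (All.map (λ (p≤ , q≤) → ≤-trans p≤ (m∸n≤m i k) , ≤-trans q≤ (m∸n≤m j k)) ws)
                   ((≤-refl , ≤-refl) ∷ []))
          (Linked-∷ʳ⁺ ps ls (All.map (λ (p≤ , q≤) → m≤o∸n⇒m+n≤o _ k≤i p≤ , m≤o∸n⇒m+n≤o _ k≤j q≤) ws))

  chain-init : ∀ {i j xs p q} → Chain i j (xs ∷ʳ (p , q)) → Chain (i ∸ k) (j ∸ k) xs
  chain-init {xs = xs} (chain ms ws ls) with All.++⁻ xs ws
  ... | _ , (p≤i , q≤j) ∷ [] =
    chain-mono (∸-monoˡ-≤ k p≤i) (∸-monoˡ-≤ k q≤j)
      (chain (All.++⁻ˡ xs ms) (within-before-last xs ls) (Linked-∷ʳ⁻ xs ls))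

  chain-tight : ∀ {i j xs p q} → Chain i j (xs ∷ʳ (p , q)) → Chain p q (xs ∷ʳ (p , q))
  chain-tight {xs = xs} {p} {q} (chain ms _ ls) =
    chain ms (All.++⁺ (All.map (λ (a , b) → ≤-trans a (m∸n≤m p k) , ≤-trans b (m∸n≤m q k))
                               (within-before-last xs ls))
                      ((≤-refl , ≤-refl) ∷ []))
          ls

  chain-shrink : ∀ {i j ps} → ¬ SameBlock i j → Chain i j ps → Chain (i ∸ 1) j ps ⊎ Chain i (j ∸ 1) ps
  chain-shrink {ps = ps} ¬same c with initLast ps
  ... | [] = inj₁ chain-[]
  ... | xs ∷ʳ′ (p , q) with All.++⁻ xs (Chain.within c) | All.++⁻ xs (Chain.matches c)
  ...   | _ , (p≤i , q≤j) ∷ [] | _ , (_ , _ , same) ∷ [] with m≤n⇒m<n∨m≡n p≤i | m≤n⇒m<n∨m≡n q≤j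
  ...     | inj₁ p<i | _        = inj₁ (chain-mono (<⇒≤pred p<i) q≤j (chain-tight c))
  ...     | inj₂ _   | inj₁ q<j = inj₂ (chain-mono p≤i (<⇒≤pred q<j) (chain-tight c))
  ...     | inj₂ refl | inj₂ refl = contradiction same ¬same

  ≤-fuel : ∀ {m n f} → m < n → n ≤ suc f → m ≤ f
  ≤-fuel m<n n≤1+f = <⇒≤pred (<-≤-trans m<n n≤1+f)

  fuel-match : ∀ {f i j} → k ≤ i → i + j ≤ suc f → (i ∸ k) + (j ∸ k) ≤ f
  fuel-match {j = j} k≤i = ≤-fuel (+-mono-<-≤ (∸-monoʳ-< 1≤k k≤i) (m∸n≤m j k))

  fuel-up : ∀ {f i j} → k ≤ i → i + j ≤ suc f → (i ∸ 1) + j ≤ f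
  fuel-up k≤i = ≤-fuel (+-mono-<-≤ (∸-monoʳ-< z<s (≤-trans 1≤k k≤i)) ≤-refl)

  fuel-left : ∀ {f i j} → k ≤ j → i + j ≤ suc f → i + (j ∸ 1) ≤ f
  fuel-left k≤j = ≤-fuel (+-mono-≤-< ≤-refl (∸-monoʳ-< z<s (≤-trans 1≤k k≤j)))

  chain-length≤M : ∀ f {i j ps} → i + j ≤ f → Chain i j ps → length ps ≤ Mf f i j
  chain-length≤M zero {i} {j} i+j≤0 c =
    ≤-reflexive (cong length (chain-below-k (inj₁ (≤-<-trans (≤-trans (m≤m+n i j) i+j≤0) 1≤k)) c))
  chain-length≤M (suc f) {i} {j} {ps} i+j≤ c with Mf (suc f) i j | recurrence f i j
  ... | _ | border b = ≤-reflexive (cong length (chain-below-k b c))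
  ... | _ | match k≤i _ _ with initLast ps
  ...   | [] = z≤n
  ...   | xs ∷ʳ′ (p , q) =
    ≤-trans (≤-reflexive (length-∷ʳ xs (p , q))) (s≤s (chain-length≤M f (fuel-match k≤i i+j≤) (chain-init c)))
  chain-length≤M (suc f) i+j≤ c | _ | mismatch k≤i k≤j ¬same with chain-shrink ¬same c
  ... | inj₁ c′ = ≤-trans (chain-length≤M f (fuel-up k≤i i+j≤) c′) (m≤n⊔m _ _)
  ... | inj₂ c′ = ≤-trans (chain-length≤M f (fuel-left k≤j i+j≤) c′) (m≤m⊔n _ _)

  M-attained : ∀ f i j → i + j ≤ f → ∃ λ ps → Chain i j ps × length ps ≡ Mf f i j
  M-attained zero    i j _ = [] , chain-[] , refl
  M-attained (suc f) i j i+j≤ with Mf (suc f) i j | recurrence f i j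
  ... | _ | border _ = [] , chain-[] , refl
  ... | _ | match k≤i k≤j same with M-attained f (i ∸ k) (j ∸ k) (fuel-match k≤i i+j≤)
  ...   | ps , c , len = ps ∷ʳ (i , j) , chain-∷ʳ (k≤i , k≤j , same) c , trans (length-∷ʳ ps (i , j)) (cong suc len)
  M-attained (suc f) i j i+j≤ | _ | mismatch k≤i k≤j _
    with ⊔-sel (Mf f i (j ∸ 1)) (Mf f (i ∸ 1) j)
       | M-attained f i (j ∸ 1) (fuel-left k≤j i+j≤) | M-attained f (i ∸ 1) j (fuel-up k≤i i+j≤)
  ... | inj₁ max≡ | ps , c , len | _ = ps , chain-mono ≤-refl (m∸n≤m j 1) c , trans len (sym max≡)
  ... | inj₂ max≡ | _ | ps , c , len = ps , chain-mono (m∸n≤m i 1) ≤-refl c , trans len (sym max≡)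

  module _ {i j : ℕ} (i≤|A| : i ≤ length A) (j≤|B| : j ≤ length B) where

    private
      A′ = take i A
      B′ = take j B

    kmatch⇒match-within : ∀ {x} → KMatch k A′ B′ x → Match x × Within i j x
    kmatch⇒match-within {p , q} (k≤p , p≤ , k≤q , q≤ , same′) =
      (k≤p , k≤q , trans (sym (substr-take (p ∸ k) A p≤i)) (trans same′ (substr-take (q ∸ k) B q≤j))) ,
      (p≤i , q≤j)
      where
        p≤i = subst (p ≤_) (length-take-≤ A i≤|A|) p≤
        q≤j = subst (q ≤_) (length-take-≤ B j≤|B|) q≤

    match-within⇒kmatch : ∀ {x} → Match x → Within i j x → KMatch k A′ B′ x
    match-within⇒kmatch {p , q} (k≤p , k≤q , same) (p≤i , q≤j) =
      k≤p , subst (p ≤_) (sym (length-take-≤ A i≤|A|)) p≤i ,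
      k≤q , subst (q ≤_) (sym (length-take-≤ B j≤|B|)) q≤j ,
      trans (substr-take (p ∸ k) A p≤i) (trans same (sym (substr-take (q ∸ k) B q≤j)))

    valid⇒chain : ∀ {ps} → ValidLCSk k A′ B′ ps → Chain i j ps
    valid⇒chain (ks , ls) = let ms , ws = All.unzip (All.map kmatch⇒match-within ks) in chain ms ws ls

    chain⇒valid : ∀ {ps} → Chain i j ps → ValidLCSk k A′ B′ ps
    chain⇒valid (chain ms ws ls) = All.zipWith (λ (m , w) → match-within⇒kmatch m w) (ms , ws) , ls

    M-isLCSk : IsLCSk k A′ B′ (M _≟_ k A B i j)
    M-isLCSk =
      (let ps , c , len = M-attained (i + j) i j ≤-refl in ps , chain⇒valid c , len) ,
      λ ps v → chain-length≤M (i + j) ≤-refl (valid⇒chain v)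

lemma1 : {Σ : Set} (_≟_ : DecidableEquality Σ) (k : ℕ) → 1 ≤ k →
         (n : ℕ) (A B : Vec Σ n) (i j : ℕ) → i ≤ n → j ≤ n →
         IsLCSk k (take i (toList A)) (take j (toList B)) (M _≟_ k (toList A) (toList B) i j)
lemma1 _≟_ k 1≤k n A B i j i≤n j≤n =
  LCSk.M-isLCSk _≟_ k 1≤k (toList A) (toList B)
    (subst (i ≤_) (sym (Vec.length-toList A)) i≤n)
    (subst (j ≤_) (sym (Vec.length-toList B)) j≤n)
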